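{- Let $G=(S_L,S_R)$ be a partizan subtraction game with $|S_L|\ge 2$ which is eventually $\mathcal L$ with preperiod at most $p$. Let $x_1,x_2\in S_L$ with $x_1<x_2$, and let $d$ be an integer with $d>p+\max(S_R\cup\{x_2-x_1\})$. Then the game $G_d=(S_L,S_R\cup\{d\})$ is eventually $\mathcal L$ with preperiod at most $(d+x_2)\left\lceil\frac{d+x_2}{x_2-x_1}\right\rceil$.
   Context: A partizan subtraction game $(S_L,S_R)$, with $S_L,S_R$ finite sets of positive integers, is played on a heap of $n$ tokens. Two players, Left and Right, alternate moves; Left removes $s\in S_L$ tokens and Right removes $s\in S_R$ tokens (at most the current heap size). A player unable to move loses. The outcome $o(n)$ is $\mathcal L$ (Left wins whoever starts), $\mathcal R$ (Right wins whoever starts), $\mathcal N$ (first player wins) or $\mathcal P$ (second player wins). A game is eventually $\mathcal L$ with preperiod at most $q$ if $o(n)=\mathcal L$ for all positions $n$ beyond the initial segment of length $q$ (i.e. the outcome sequence is constantly $\mathcal L$ from index $q$ on). -}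

module Defs where

open import Data.Nat using (ℕ; zero; suc; _+_; _∸_; _≤ᵇ_; _⊔_)
open import Data.Nat.DivMod using (_/_)
open import Data.Bool using (Bool; true; false; not; _∧_)
open import Data.List using (List; []; _∷_; foldr)
open import Data.Bool.ListAction using (any)
open import Data.Product using (_×_; _,_; proj₁; proj₂)
open import Relation.Binary.PropositionalEquality using (_≡_)

-- A position value: (Left moving first wins , Right moving first wins).
-- Table of values for heaps n-1, n-2, ..., 0 (head = heap n-1).

-- entry at index i of the table (heap n-1-i); default irrelevant (never used
-- for legal moves)
at : List (Bool × Bool) → ℕ → Bool × Bool
at []       _       = (false , false)
at (x ∷ _)  zero    = x
at (_ ∷ xs) (suc i) = at xs i

module _ (SL SR : List ℕ) where

  -- a move removing s tokens is legal from a heap of size n iff 1 ≤ s ≤ n;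
  -- the resulting heap n - s sits at index s - 1 of the table of heap n
  legal : ℕ → ℕ → Bool
  legal n zero    = false
  legal n (suc s) = suc s ≤ᵇ n

  step : ℕ → List (Bool × Bool) → Bool × Bool
  step n tbl =
    ( any (λ s → legal n s ∧ not (proj₂ (at tbl (s ∸ 1)))) SL
    , any (λ s → legal n s ∧ not (proj₁ (at tbl (s ∸ 1)))) SR )

  table : ℕ → List (Bool × Bool)
  table zero    = []
  table (suc n) = step n (table n) ∷ table n

  leftWinsFirst : ℕ → Bool
  leftWinsFirst n = proj₁ (step n (table n))

  rightWinsFirst : ℕ → Bool
  rightWinsFirst n = proj₂ (step n (table n))

data Outcome : Set where
  𝓛 𝓡 𝓝 𝓟 : Outcome

outcome : List ℕ → List ℕ → ℕ → Outcome
outcome SL SR n with leftWinsFirst SL SR n | rightWinsFirst SL SR n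
... | true  | false = 𝓛
... | false | true  = 𝓡
... | true  | true  = 𝓝
... | false | false = 𝓟

EventuallyLWithPreperiod≤ : List ℕ → List ℕ → ℕ → Set
EventuallyLWithPreperiod≤ SL SR q =
  ∀ n → q Data.Nat.≤ n → outcome SL SR n ≡ 𝓛

maxWith : ℕ → List ℕ → ℕ
maxWith = foldr _⊔_

-- ⌈ a / b ⌉ for b > 0 (value for b = 0 irrelevant)
ceilDiv : ℕ → ℕ → ℕ
ceilDiv a zero    = 0
ceilDiv a (suc b) = (a + b) / suc b

module Submission where

-- Positions below d do not see the new move, so [p, d) stays 𝓛. From a position n ≥ p,
-- whenever Right wins moving first, removing d also wins: if Right's winning move removes
-- s ∈ SR, then n ≥ d and every move of Left from n − d is answered by Right removing s
-- (strong induction on n, using d − s > p). Hence if Left wins first from w she also wins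
-- from d + x + w for x ∈ SL, as Right's only possible win from d + w would land on w.
-- Starting from [p, d), Left's first-player wins thus contain all w + i (d + x₁) + j (d + x₂),
-- which covers every position past m (d + x₁) + p once m (x₂ − x₁) ≥ d + x₁; a further d on,
-- Right has no winning move either.

open import Defs
open import Data.Bool using (Bool; true; false; not; _∧_; T)
open import Data.Bool.ListAction using (any)
open import Data.Bool.Properties using (T-∧)
open import Data.List using (List; []; _∷_; length)
open import Data.List.Membership.Propositional using (_∈_; find; lose)
open import Data.List.Relation.Unary.All using (All)
import Data.List.Relation.Unary.All as All
open import Data.List.Relation.Unary.Any using (here; there)
open import Data.List.Relation.Unary.Any.Properties using (any⁺; any⁻)
open import Data.List.Relation.Unary.Unique.Propositional using (Unique)
open import Data.Nat
open import Data.Nat.DivMod using (_/_; _%_; m≡m%n+[m/n]*n; m%n<n)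
open import Data.Nat.Induction using (<-rec)
open import Data.Nat.Properties
open import Data.Nat.Tactic.RingSolver using (solve)
open import Data.Product using (_×_; _,_; proj₁; proj₂; ∃-syntax)
open import Function using (_∘_; Equivalence)
open import Relation.Binary.PropositionalEquality
open import Relation.Nullary using (¬_; yes; no; contradiction)
open import Relation.Nullary.Decidable using (T?)

module _ (SL SR : List ℕ) where

  winsFirst : ℕ → Bool × Bool
  winsFirst n = step SL SR n (table SL SR n)

  LeftWins RightWins : ℕ → Set
  LeftWins n = T (leftWinsFirst SL SR n)
  RightWins n = T (rightWinsFirst SL SR n)

  private
    T-not⇒¬T : ∀ {b} → T (not b) → ¬ T b
    T-not⇒¬T {false} _ ()

    ¬T⇒T-not : ∀ {b} → ¬ T b → T (not b)
    ¬T⇒T-not {false} _ = _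
    ¬T⇒T-not {true} ¬b = ¬b _

    at-table : ∀ {t n} → t < n → at (table SL SR n) t ≡ winsFirst (n ∸ suc t)
    at-table {zero} {suc n} _ = refl
    at-table {suc t} {suc n} (s≤s t<n) = at-table t<n

    winningMove : (Bool × Bool → Bool) → ℕ → ℕ → Bool
    winningMove opponentWins n s = legal SL SR n s ∧ not (opponentWins (at (table SL SR n) (s ∸ 1)))

    move⁻ : ∀ opponentWins S n → T (any (winningMove opponentWins n) S) →
            ∃[ s ] ∃[ b ] s ∈ S × 0 < s × n ≡ s + b × ¬ T (opponentWins (winsFirst b))
    move⁻ opponentWins S n win with find (any⁻ _ S win)
    ... | suc t , s∈S , escapes =
      suc t , n ∸ suc t , s∈S , z<s , sym (m+[n∸m]≡n s≤n) ,
      subst (λ x → ¬ T (opponentWins x)) (at-table s≤n) (T-not⇒¬T not-opponentWins)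
      where
      s≤n = ≤ᵇ⇒≤ (suc t) n (proj₁ (Equivalence.to T-∧ escapes))
      not-opponentWins = proj₂ (Equivalence.to T-∧ escapes)

    move⁺ : ∀ opponentWins S {s b} → s ∈ S → 0 < s → ¬ T (opponentWins (winsFirst b)) →
            T (any (winningMove opponentWins (s + b)) S)
    move⁺ opponentWins S {suc t} {b} s∈S _ ¬win =
      any⁺ _ (lose s∈S (Equivalence.from T-∧ (≤⇒≤ᵇ (m≤m+n (suc t) b) , ¬T⇒T-not ¬win′)))
      where
      ¬win′ : ¬ T (opponentWins (at (table SL SR (suc t + b)) t))
      ¬win′ rewrite at-table (m≤m+n (suc t) b) | m+n∸m≡n (suc t) b = ¬win

  leftWins⁻ : ∀ {n} → LeftWins n → ∃[ s ] ∃[ b ] s ∈ SL × 0 < s × n ≡ s + b × ¬ RightWins b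
  leftWins⁻ = move⁻ proj₂ SL _

  leftWins⁺ : ∀ {s b} → s ∈ SL → 0 < s → ¬ RightWins b → LeftWins (s + b)
  leftWins⁺ = move⁺ proj₂ SL

  rightWins⁻ : ∀ {n} → RightWins n → ∃[ s ] ∃[ b ] s ∈ SR × 0 < s × n ≡ s + b × ¬ LeftWins b
  rightWins⁻ = move⁻ proj₁ SR _

  rightWins⁺ : ∀ {s b} → s ∈ SR → 0 < s → ¬ LeftWins b → RightWins (s + b)
  rightWins⁺ = move⁺ proj₁ SR

  ¬leftWins⇒rightWins : ∀ {x y} → x ∈ SL → 0 < x → ¬ LeftWins (x + y) → RightWins y
  ¬leftWins⇒rightWins {y = y} x∈SL 0<x ¬win with T? (rightWinsFirst SL SR y)
  ... | yes win = win
  ... | no ¬win′ = contradiction (leftWins⁺ x∈SL 0<x ¬win′) ¬win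

  outcome≡𝓛⁻ : ∀ {n} → outcome SL SR n ≡ 𝓛 → LeftWins n × ¬ RightWins n
  outcome≡𝓛⁻ {n} eq with leftWinsFirst SL SR n | rightWinsFirst SL SR n
  outcome≡𝓛⁻ refl | true  | false = _ , λ ()
  outcome≡𝓛⁻ ()   | true  | true
  outcome≡𝓛⁻ ()   | false | true
  outcome≡𝓛⁻ ()   | false | false

  outcome≡𝓛⁺ : ∀ {n} → LeftWins n → ¬ RightWins n → outcome SL SR n ≡ 𝓛
  outcome≡𝓛⁺ {n} win ¬win with leftWinsFirst SL SR n | rightWinsFirst SL SR n
  outcome≡𝓛⁺ _  _    | true  | false = refl
  outcome≡𝓛⁺ _  ¬win | true  | true  = contradiction _ ¬win
  outcome≡𝓛⁺ () _    | false | _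

module _ (SL SR : List ℕ) where

  step-∷-beyond : ∀ {d n} tbl → n < d → step SL (d ∷ SR) n tbl ≡ step SL SR n tbl
  step-∷-beyond {suc d′} {n} tbl (s≤s n≤d′) with d′ <ᵇ n in d-legal
  ... | true = contradiction n≤d′ (<⇒≱ (<ᵇ⇒< d′ n (subst T (sym d-legal) _)))
  ... | false = refl

  table-∷-beyond : ∀ {d n} → n ≤ d → table SL (d ∷ SR) n ≡ table SL SR n
  table-∷-beyond {n = zero} _ = refl
  table-∷-beyond {n = suc n} n<d
    rewrite table-∷-beyond (<⇒≤ n<d) = cong (_∷ table SL SR n) (step-∷-beyond (table SL SR n) n<d)

  winsFirst-∷-beyond : ∀ {d n} → n < d → winsFirst SL (d ∷ SR) n ≡ winsFirst SL SR n
  winsFirst-∷-beyond {d} {n} n<d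
    rewrite table-∷-beyond {d} (<⇒≤ n<d) = step-∷-beyond (table SL SR n) n<d

quotRem : ∀ t D .{{_ : NonZero D}} → ∃[ q ] ∃[ r ] r < D × t ≡ r + q * D
quotRem t D = t / D , t % D , m%n<n t D , m≡m%n+[m/n]*n t D

decomposition : ∀ {g D m} .{{_ : NonZero g}} .{{_ : NonZero D}} → g ≤ m * D → ∀ t →
                ∃[ i ] ∃[ j ] ∃[ r ] r < D × m * g + t ≡ i * g + (j * (g + D) + r)
decomposition {g} {D} {m} g≤mD t with quotRem t g
... | k , u , u<g , refl with quotRem u D
...   | j , r , r<D , refl
  with m≤n⇒∃[o]m+o≡n (<⇒≤ (*-cancelʳ-< D j m (<-≤-trans (≤-<-trans (m≤n+m (j * D) r) u<g) g≤mD)))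
...     | i , refl = i + k , j , r , r<D , solve (j ∷ i ∷ g ∷ r ∷ D ∷ k ∷ [])

+-closed⇒*+-closed : ∀ (P : ℕ → Set) {g} → (∀ {w} → P w → P (g + w)) → ∀ i {w} → P w → P (i * g + w)
+-closed⇒*+-closed P step zero pw = pw
+-closed⇒*+-closed P {g} step (suc i) {w} pw =
  subst P (sym (+-assoc g (i * g) w)) (step (+-closed⇒*+-closed P step i pw))

≤-maxWith : ∀ z xs → z ≤ maxWith z xs
≤-maxWith z [] = ≤-refl
≤-maxWith z (y ∷ ys) = ≤-trans (≤-maxWith z ys) (m≤n⊔m y _)

∈⇒≤-maxWith : ∀ z {s xs} → s ∈ xs → s ≤ maxWith z xs
∈⇒≤-maxWith z {xs = y ∷ ys} (here refl) = m≤m⊔n y _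
∈⇒≤-maxWith z {xs = y ∷ ys} (there s∈ys) = ≤-trans (∈⇒≤-maxWith z s∈ys) (m≤n⊔m y _)

≤-ceilDiv* : ∀ a b .{{_ : NonZero b}} → a ≤ ceilDiv a b * b
≤-ceilDiv* a (suc b) = +-cancelʳ-≤ b a _ (begin
  a + b                                       ≡⟨ m≡m%n+[m/n]*n (a + b) (suc b) ⟩
  (a + b) % suc b + ceilDiv a (suc b) * suc b ≤⟨ +-monoˡ-≤ _ (s≤s⁻¹ (m%n<n (a + b) (suc b))) ⟩
  b + ceilDiv a (suc b) * suc b               ≡⟨ +-comm b _ ⟩
  ceilDiv a (suc b) * suc b + b               ∎)
  where open ≤-Reasoning

EventuallyL-mono : ∀ {SL SR q q′} → q ≤ q′ →
                   EventuallyLWithPreperiod≤ SL SR q → EventuallyLWithPreperiod≤ SL SR q′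
EventuallyL-mono q≤q′ eventuallyL n q′≤n = eventuallyL n (≤-trans q≤q′ q′≤n)

module AddingLargeRightMove
  (SL SR : List ℕ) (p : ℕ) (eventuallyL : EventuallyLWithPreperiod≤ SL SR p)
  (d : ℕ) (p<d : p < d) (p+SR<d : ∀ {s} → s ∈ SR → p + s < d)
  where

  private
    SR′ : List ℕ
    SR′ = d ∷ SR

    LeftWins′ RightWins′ : ℕ → Set
    LeftWins′ = LeftWins SL SR′
    RightWins′ = RightWins SL SR′

  RightWinsByD : ℕ → Set
  RightWinsByD n = ∃[ a ] n ≡ d + a × ¬ LeftWins′ a

  𝓛-below-d : ∀ {n} → p ≤ n → n < d → LeftWins′ n × ¬ RightWins′ n
  𝓛-below-d p≤n n<d =
    subst (T ∘ proj₁) (sym same) win , ¬win ∘ subst (T ∘ proj₂) same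
    where
    same = winsFirst-∷-beyond SL SR n<d
    win = proj₁ (outcome≡𝓛⁻ SL SR (eventuallyL _ p≤n))
    ¬win = proj₂ (outcome≡𝓛⁻ SL SR (eventuallyL _ p≤n))

  private
    d-split : ∀ {s} → s ∈ SR → ∃[ e ] s + e ≡ d × p < e
    d-split {s} s∈SR =
      d ∸ s , m+[n∸m]≡n (m+n≤o⇒n≤o p (<⇒≤ (p+SR<d s∈SR))) , m+n≤o⇒m≤o∸n (suc p) (p+SR<d s∈SR)

  -- Write d = s + e. Left loses first at b = x + (e + c), so Right wins first at e + c, by the
  -- induction hypothesis by removing d = s + e; that is, Right wins at c by removing s.
  rightWins-after-leftReply :
    ∀ {n s b x c} → s ∈ SR → 0 < s → n ≡ s + b → ¬ LeftWins′ b →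
    x ∈ SL → 0 < x → n ≡ d + (x + c) →
    (∀ {m} → m < n → p ≤ m → RightWins′ m → RightWinsByD m) → RightWins′ c
  rightWins-after-leftReply {n} {s} {b} {x} {c} s∈SR 0<s n≡s+b ¬win-b x∈SL 0<x n≡d+[x+c] rec
    with d-split s∈SR
  ... | e , s+e≡d , p<e with rec e+c<n (≤-trans (<⇒≤ p<e) (m≤m+n e c)) win-e+c
    where
    b≡x+[e+c] : b ≡ x + (e + c)
    b≡x+[e+c] = +-cancelˡ-≡ s b _ (begin
      s + b             ≡⟨ trans (sym n≡s+b) n≡d+[x+c] ⟩
      d + (x + c)       ≡⟨ cong (_+ (x + c)) (sym s+e≡d) ⟩
      s + e + (x + c)   ≡⟨ solve (s ∷ e ∷ x ∷ c ∷ []) ⟩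
      s + (x + (e + c)) ∎)
      where open ≡-Reasoning
    e+c<n : e + c < n
    e+c<n = begin-strict
      e + c       <⟨ m<n+m (e + c) 0<x ⟩
      x + (e + c) ≡⟨ b≡x+[e+c] ⟨
      b           ≤⟨ m≤n+m b s ⟩
      s + b       ≡⟨ n≡s+b ⟨
      n           ∎
      where open ≤-Reasoning
    win-e+c : RightWins′ (e + c)
    win-e+c = ¬leftWins⇒rightWins SL SR′ x∈SL 0<x (subst (¬_ ∘ LeftWins′) b≡x+[e+c] ¬win-b)
  ... | a′ , e+c≡d+a′ , ¬win-a′ =
    subst RightWins′ (sym c≡s+a′) (rightWins⁺ SL SR′ (there s∈SR) 0<s ¬win-a′)
    where
    c≡s+a′ : c ≡ s + a′
    c≡s+a′ = +-cancelˡ-≡ e c _ (begin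
      e + c        ≡⟨ e+c≡d+a′ ⟩
      d + a′       ≡⟨ cong (_+ a′) (sym s+e≡d) ⟩
      s + e + a′   ≡⟨ solve (s ∷ e ∷ a′ ∷ []) ⟩
      e + (s + a′) ∎)
      where open ≡-Reasoning

  rightWins⇒byD : ∀ n → p ≤ n → RightWins′ n → RightWinsByD n
  rightWins⇒byD = <-rec _ go
    where
    go : ∀ n → (∀ {m} → m < n → p ≤ m → RightWins′ m → RightWinsByD m) →
         p ≤ n → RightWins′ n → RightWinsByD n
    go n rec p≤n win with rightWins⁻ SL SR′ win
    ... | _ , b , here refl , _ , n≡d+b , ¬win-b = b , n≡d+b , ¬win-b
    ... | s , b , there s∈SR , 0<s , n≡s+b , ¬win-b with d ≤? n
    ...   | no n≱d = contradiction win (proj₂ (𝓛-below-d p≤n (≰⇒> n≱d)))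
    ...   | yes d≤n = n ∸ d , sym n≡d+a , ¬win-a
      where
      n≡d+a = m+[n∸m]≡n d≤n
      ¬win-a : ¬ LeftWins′ (n ∸ d)
      ¬win-a win-a with leftWins⁻ SL SR′ win-a
      ... | x , c , x∈SL , 0<x , a≡x+c , ¬win-c =
        ¬win-c (rightWins-after-leftReply s∈SR 0<s n≡s+b ¬win-b x∈SL 0<x
                  (trans (sym n≡d+a) (cong (d +_) a≡x+c)) rec)

  leftWins-+ : ∀ {x w} → x ∈ SL → 0 < x → LeftWins′ w → LeftWins′ (d + x + w)
  leftWins-+ {x} {w} x∈SL 0<x win-w with T? (rightWinsFirst SL SR′ (d + w))
  ... | no ¬win = subst LeftWins′ (trans (sym (+-assoc x d w)) (cong (_+ w) (+-comm x d)))
                   (leftWins⁺ SL SR′ x∈SL 0<x ¬win)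
  ... | yes win with rightWins⇒byD (d + w) (≤-trans (<⇒≤ p<d) (m≤m+n d w)) win
  ...   | a , d+w≡d+a , ¬win-a =
    contradiction (subst LeftWins′ (+-cancelˡ-≡ d w a d+w≡d+a) win-w) ¬win-a

  leftWins-beyond : ∀ {x D m} .{{_ : NonZero D}} → x ∈ SL → x + D ∈ SL → 0 < x → p + D ≤ d →
                    d + x ≤ m * D → ∀ {a} → m * (d + x) + p ≤ a → LeftWins′ a
  leftWins-beyond {x} {D} {m} x∈SL x+D∈SL 0<x p+D≤d d+x≤mD m[d+x]+p≤a
    with m≤n⇒∃[o]m+o≡n m[d+x]+p≤a
  ... | t , refl with decomposition {m = m} {{>-nonZero (<-≤-trans 0<x (m≤n+m x d))}} d+x≤mD t
  ...   | i , j , r , r<D , eq =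
    subst LeftWins′ a≡ (+-closed⇒*+-closed LeftWins′ (leftWins-+ x∈SL 0<x) i
                         (+-closed⇒*+-closed LeftWins′ leftWins-+[x+D] j win-p+r))
    where
    leftWins-+[x+D] : ∀ {w} → LeftWins′ w → LeftWins′ (d + x + D + w)
    leftWins-+[x+D] {w} = subst (λ y → LeftWins′ (y + w)) (sym (+-assoc d x D))
                        ∘ leftWins-+ x+D∈SL (<-≤-trans 0<x (m≤m+n x D))
    win-p+r : LeftWins′ (p + r)
    win-p+r = proj₁ (𝓛-below-d (m≤m+n p r) (<-≤-trans (+-monoʳ-< p r<D) p+D≤d))
    a≡ : i * (d + x) + (j * (d + x + D) + (p + r)) ≡ m * (d + x) + p + t
    a≡ = begin
      i * (d + x) + (j * (d + x + D) + (p + r)) ≡⟨ solve (i ∷ d ∷ x ∷ j ∷ D ∷ p ∷ r ∷ []) ⟩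
      i * (d + x) + (j * (d + x + D) + r) + p   ≡⟨ cong (_+ p) eq ⟨
      m * (d + x) + t + p                       ≡⟨ solve (m ∷ d ∷ x ∷ t ∷ p ∷ []) ⟩
      m * (d + x) + p + t                       ∎
      where open ≡-Reasoning

  eventuallyL-from : ∀ N → (∀ {a} → N ≤ a → LeftWins′ a) → EventuallyLWithPreperiod≤ SL SR′ (d + N)
  eventuallyL-from N win n d+N≤n = outcome≡𝓛⁺ SL SR′ (win (m+n≤o⇒n≤o d d+N≤n)) ¬win
    where
    p≤n = ≤-trans (<⇒≤ p<d) (m+n≤o⇒m≤o d d+N≤n)
    ¬win : ¬ RightWins′ n
    ¬win win-n with rightWins⇒byD n p≤n win-n
    ... | a , refl , ¬win-a = ¬win-a (win (+-cancelˡ-≤ d N a d+N≤n))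

  eventuallyL-beyond : ∀ {x₁ x₂ K} → x₁ ∈ SL → x₂ ∈ SL → 0 < x₁ → x₁ < x₂ → p + (x₂ ∸ x₁) ≤ d →
                       d + x₂ ≤ K * (x₂ ∸ x₁) → EventuallyLWithPreperiod≤ SL SR′ ((d + x₂) * K)
  eventuallyL-beyond {K = zero} _ _ _ _ _ d+x₂≤0 =
    contradiction (≤-trans (m≤m+n d _) d+x₂≤0) (<⇒≱ (≤-<-trans z≤n p<d))
  eventuallyL-beyond {x₁} {x₂} {suc m} x₁∈SL x₂∈SL 0<x₁ x₁<x₂ p+D≤d d+x₂≤[1+m]D =
    EventuallyL-mono {SL} {SR′} threshold≤ (eventuallyL-from (m * (d + x₁) + p)
      (leftWins-beyond {m = m} {{>-nonZero (m<n⇒0<n∸m x₁<x₂)}}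
         x₁∈SL (subst (_∈ SL) (sym x₁+D≡x₂) x₂∈SL) 0<x₁ p+D≤d d+x₁≤mD))
    where
    D = x₂ ∸ x₁
    x₁+D≡x₂ : x₁ + D ≡ x₂
    x₁+D≡x₂ = m+[n∸m]≡n (<⇒≤ x₁<x₂)
    d+x₁≤mD : d + x₁ ≤ m * D
    d+x₁≤mD = +-cancelʳ-≤ D (d + x₁) (m * D) (begin
      d + x₁ + D   ≡⟨ trans (+-assoc d x₁ D) (cong (d +_) x₁+D≡x₂) ⟩
      d + x₂       ≤⟨ d+x₂≤[1+m]D ⟩
      D + m * D    ≡⟨ +-comm D (m * D) ⟩
      m * D + D    ∎)
      where open ≤-Reasoning
    p≤mD : p ≤ m * D
    p≤mD = ≤-trans (<⇒≤ p<d) (≤-trans (m≤m+n d x₁) d+x₁≤mD)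
    threshold≤ : d + (m * (d + x₁) + p) ≤ (d + x₂) * suc m
    threshold≤ = begin
      d + (m * (d + x₁) + p)     ≤⟨ +-monoʳ-≤ d (+-monoʳ-≤ (m * (d + x₁)) p≤mD) ⟩
      d + (m * (d + x₁) + m * D) ≡⟨ cong (d +_) (*-distribˡ-+ m (d + x₁) D) ⟨
      d + m * (d + x₁ + D)       ≡⟨ cong (λ y → d + m * y) (trans (+-assoc d x₁ D) (cong (d +_) x₁+D≡x₂)) ⟩
      d + m * (d + x₂)           ≤⟨ +-monoˡ-≤ (m * (d + x₂)) (m≤m+n d x₂) ⟩
      d + x₂ + m * (d + x₂)      ≡⟨ *-comm (suc m) (d + x₂) ⟩
      (d + x₂) * suc m           ∎
      where open ≤-Reasoning

mainTheorem5 : (SL SR : List ℕ) → Unique SL → Unique SR →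
    All (0 <_) SL → All (0 <_) SR → 2 ≤ length SL →
    (p : ℕ) → EventuallyLWithPreperiod≤ SL SR p →
    (x₁ x₂ : ℕ) → x₁ ∈ SL → x₂ ∈ SL → x₁ < x₂ →
    (d : ℕ) → p + maxWith (x₂ ∸ x₁) SR < d →
    EventuallyLWithPreperiod≤ SL (d ∷ SR)
      ((d + x₂) * ceilDiv (d + x₂) (x₂ ∸ x₁))
mainTheorem5 SL SR _ _ SL-positive _ _ p eventuallyL x₁ x₂ x₁∈SL x₂∈SL x₁<x₂ d p+max<d =
  eventuallyL-beyond x₁∈SL x₂∈SL (All.lookup SL-positive x₁∈SL) x₁<x₂
    (<⇒≤ (p+≤max<d (≤-maxWith _ SR)))
    (≤-ceilDiv* (d + x₂) (x₂ ∸ x₁) {{>-nonZero (m<n⇒0<n∸m x₁<x₂)}})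
  where
  p+≤max<d : ∀ {s} → s ≤ maxWith (x₂ ∸ x₁) SR → p + s < d
  p+≤max<d s≤max = ≤-<-trans (+-monoʳ-≤ p s≤max) p+max<d
  open AddingLargeRightMove SL SR p eventuallyL d (≤-<-trans (m≤m+n p _) p+max<d) (p+≤max<d ∘ ∈⇒≤-maxWith _)
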